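{- Let $\alpha\ge1$, $\beta\ge1$ be integers and $n\ge1$. Consider the $(\alpha,\beta)$ binary search problem on a sorted array $V=(v_0<v_1<\dots<v_{n-1})$. Then every deterministic comparison-based search procedure for this problem has worst-case cost at least $k$, where $k$ is the minimum integer $k\ge0$ with $G(k)\ge n$.
   Context: Let $\ell=\min\{\alpha,\beta\}$. Define $g(k)=0$ for $k<0$, $g(0)=1$, $g(k)=g(k-\alpha)+g(k-\beta)$ for $k\ge1$, and $G(k)=\sum_{i=1}^{\ell} g(k+1-i)$. The $(\alpha,\beta)$ binary search problem: an unknown value $x$ is known to equal one of the items of $V$; the only available operation is a comparison "$x\le v_j$?" for an index $j$, which costs $\alpha$ if its outcome is true and $\beta$ if its outcome is false. A deterministic comparison-based search procedure chooses each comparison based only on the outcomes of the previous ones and must eventually determine the index $i$ with $v_i=x$. The cost of a search is the sum of the costs of the comparisons performed; the worst-case cost is the maximum of this cost over all $x\in V$. -}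

module Defs where

open import Data.Nat using (ℕ; zero; suc; _+_; _∸_; _≤_; _⊔_; _⊓_; _≤ᵇ_)
open import Data.Product using (_×_)
open import Data.Bool using (Bool; true; false; if_then_else_)
open import Data.Fin using (Fin; toℕ)
open import Data.List using (List; map; foldr; allFin)
open import Relation.Binary.PropositionalEquality using (_≡_)

-- The sequences g and G (parameters α β).
-- g(k) = 0 (k<0), g(0) = 1, g(k) = g(k-α) + g(k-β) (k ≥ 1).
-- Negative arguments are handled by the guard "a ≤ k" below.
-- gAux uses a fuel argument (fuel ≥ argument suffices, since α,β ≥ 1).

gAux : ℕ → ℕ → ℕ → ℕ → ℕ
gAux α β _        zero    = 1
gAux α β zero     (suc k) = 0
gAux α β (suc f) (suc k) = term α + term β
  where
  term : ℕ → ℕ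
  term a = if a ≤ᵇ suc k then gAux α β f (suc k ∸ a) else 0

g : ℕ → ℕ → ℕ → ℕ
g α β k = gAux α β k k

-- g at the (possibly negative) integer  (k + 1 - i):  zero when i > k + 1.
gShift : ℕ → ℕ → ℕ → ℕ → ℕ
gShift α β k i = if i ≤ᵇ suc k then g α β (suc k ∸ i) else 0

sumTo : ℕ → ℕ → ℕ → ℕ → ℕ
sumTo α β k zero    = 0
sumTo α β k (suc m) = sumTo α β k m + gShift α β k (suc m)

G : ℕ → ℕ → ℕ → ℕ
G α β k = sumTo α β k (α ⊓ β)

-- Deterministic comparison-based search procedures on an array
-- v_0 < ... < v_{n-1}, modelled as (finite) decision trees.
-- node j t f : ask "x ≤ v_j ?"; continue with t if true, f if false.
-- leaf i     : answer index i.

data SearchTree (n : ℕ) : Set where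
  leaf : Fin n → SearchTree n
  node : Fin n → SearchTree n → SearchTree n → SearchTree n

-- Outcome of "x ≤ v_j ?" when x = v_i (array sorted, distinct): i ≤ j.
answer : ∀ {n} → Fin n → Fin n → Bool
answer i j = toℕ i ≤ᵇ toℕ j

result : ∀ {n} → SearchTree n → Fin n → Fin n
result (leaf r)     i = r
result (node j t f) i = if answer i j then result t i else result f i

cost : ℕ → ℕ → ∀ {n} → SearchTree n → Fin n → ℕ
cost α β (leaf r)     i = 0
cost α β (node j t f) i =
  if answer i j then α + cost α β t i else β + cost α β f i

Correct : ∀ {n} → SearchTree n → Set
Correct {n} T = ∀ (i : Fin n) → result T i ≡ i

worstCost : ℕ → ℕ → ∀ {n} → SearchTree n → ℕ
worstCost α β {n} T = foldr _⊔_ 0 (map (cost α β T) (allFin n))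

IsMinK : ℕ → ℕ → ℕ → ℕ → Set
IsMinK α β n k = (n ≤ G α β k) × (∀ m → n ≤ G α β m → k ≤ m)

-- Extend G to integers by G(c − a) := Σ_{i=1}^{ℓ} g(c + 1 − a − i), with
-- g = 0 at negative arguments; this is Gminus c a below.  The recurrence
-- g(x) = g(x − α) + g(x − β), summed over a window of ℓ = min(α, β)
-- consecutive values, gives the key inequality
--     Gminus c α + Gminus c β ≤ G(c)          (equality once ℓ ≤ c),
-- together with G(c) ≥ 1 and Gminus c a = G(c − a) for a ≤ c.
--
-- For trees, we track a subtree T reached at accumulated cost a that must
-- identify every index of an interval [lo, hi) within total budget c.  By
-- induction on T, such an interval has at most Gminus c a elements: a leaf
-- identifies one index; a node "x ≤ v_j ?" splits the interval at j + 1
-- into a part handled by the true branch (one step more costly by α) and a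
-- part handled by the false branch (by β), and the key inequality adds
-- the two bounds up.  The whole array is the case a = 0, [0, n), and the
-- theorem follows from the minimality of k.
module Submission where

open import Defs
open import Data.Nat using (ℕ; zero; suc; _+_; _∸_; _≤_; _<_; _⊔_; _⊓_; _≤ᵇ_; z≤n; s≤s; s≤s⁻¹; _≤?_)
open import Data.Nat.Properties
open import Data.Nat.Induction using (<-rec)
open import Data.Bool.Properties using (T-≡; ¬-not)
open import Data.Bool using (true; false; if_then_else_)
open import Data.Empty using (⊥-elim)
open import Data.Sum using (inj₁; inj₂)
open import Data.Product using (Σ; _×_; _,_)
open import Data.Fin using (Fin; toℕ; fromℕ<)
open import Data.Fin.Properties using (toℕ-fromℕ<)
open import Data.List using (map; foldr)
open import Data.List.Membership.Propositional using (_∈_)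
open import Data.List.Membership.Propositional.Properties using (∈-allFin)
open import Data.List.Relation.Unary.Any using (here; there)
open import Algebra.Properties.CommutativeSemigroup +-commutativeSemigroup using (interchange)
open import Function.Bundles using (Equivalence)
open import Relation.Nullary using (yes; no)
open import Relation.Binary.PropositionalEquality

≤ᵇ-true : ∀ {m n} → m ≤ n → (m ≤ᵇ n) ≡ true
≤ᵇ-true m≤n = Equivalence.to T-≡ (≤⇒≤ᵇ m≤n)

≤ᵇ-false : ∀ {m n} → n < m → (m ≤ᵇ n) ≡ false
≤ᵇ-false {m} {n} n<m =
  ¬-not {y = true} (λ eq → <⇒≱ n<m (≤ᵇ⇒≤ m n (Equivalence.from T-≡ eq)))

spend : ∀ a {y c} → a + y ≤ c → y ≤ c ∸ a
spend a {y} {c} a+y≤c = m+n≤o⇒m≤o∸n y (subst (_≤ c) (+-comm a y) a+y≤c)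

∑ : (ℕ → ℕ) → ℕ → ℕ
∑ f zero    = 0
∑ f (suc m) = ∑ f m + f (suc m)

∑-cong : ∀ {f h} m → (∀ i → 1 ≤ i → i ≤ m → f i ≡ h i) → ∑ f m ≡ ∑ h m
∑-cong zero    f≗h = refl
∑-cong (suc m) f≗h =
  cong₂ _+_ (∑-cong m (λ i 1≤i i≤m → f≗h i 1≤i (m≤n⇒m≤1+n i≤m))) (f≗h (suc m) (s≤s z≤n) ≤-refl)

∑-zero : ∀ {f} m → (∀ i → 1 ≤ i → i ≤ m → f i ≡ 0) → ∑ f m ≡ 0
∑-zero zero    f≗0 = refl
∑-zero (suc m) f≗0 =
  cong₂ _+_ (∑-zero m (λ i 1≤i i≤m → f≗0 i 1≤i (m≤n⇒m≤1+n i≤m))) (f≗0 (suc m) (s≤s z≤n) ≤-refl)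

∑-+ : ∀ f h m → ∑ (λ i → f i + h i) m ≡ ∑ f m + ∑ h m
∑-+ f h zero    = refl
∑-+ f h (suc m) =
  trans (cong (_+ (f (suc m) + h (suc m))) (∑-+ f h m)) (interchange (∑ f m) (∑ h m) _ _)

∑-term : ∀ f m i → 1 ≤ i → i ≤ m → f i ≤ ∑ f m
∑-term f zero    i 1≤i i≤0   = ⊥-elim (<⇒≱ 1≤i i≤0)
∑-term f (suc m) i 1≤i i≤1+m with m≤n⇒m<n∨m≡n i≤1+m
... | inj₁ i<1+m = ≤-trans (∑-term f m i 1≤i (s≤s⁻¹ i<1+m)) (m≤m+n _ _)
... | inj₂ refl  = m≤n+m _ _

≤-foldr-⊔ : ∀ {A : Set} (h : A → ℕ) {xs x} → x ∈ xs → h x ≤ foldr _⊔_ 0 (map h xs)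
≤-foldr-⊔ h (here refl) = m≤m⊔n _ _
≤-foldr-⊔ h (there x∈xs) = ≤-trans (≤-foldr-⊔ h x∈xs) (m≤n⊔m _ _)

module Recurrence (α β : ℕ) (1≤α : 1 ≤ α) (1≤β : 1 ≤ β) where

  ℓ : ℕ
  ℓ = α ⊓ β

  gAt : ℕ → ℕ → ℕ
  gAt x a = if a ≤ᵇ x then g α β (x ∸ a) else 0

  gAt-above : ∀ {x a} → a ≤ x → gAt x a ≡ g α β (x ∸ a)
  gAt-above a≤x rewrite ≤ᵇ-true a≤x = refl

  gAt-below : ∀ {x a} → x < a → gAt x a ≡ 0
  gAt-below x<a rewrite ≤ᵇ-false x<a = refl

  gAt-shift : ∀ x j a → j ≤ x → gAt (x ∸ j) a ≡ gAt x (j + a)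
  gAt-shift x j a j≤x with j + a ≤? x
  ... | yes j+a≤x = begin
    gAt (x ∸ j) a       ≡⟨ gAt-above (m+n≤o⇒m≤o∸n a (subst (_≤ x) (+-comm j a) j+a≤x)) ⟩
    g α β (x ∸ j ∸ a)   ≡⟨ cong (g α β) (∸-+-assoc x j a) ⟩
    g α β (x ∸ (j + a)) ≡⟨ sym (gAt-above j+a≤x) ⟩
    gAt x (j + a)       ∎
    where open ≡-Reasoning
  ... | no j+a≰x = trans (gAt-below x∸j<a) (sym (gAt-below (≰⇒> j+a≰x)))
    where
    x∸j<a : x ∸ j < a
    x∸j<a = ≰⇒> (λ a≤x∸j → j+a≰x (subst (_≤ x) (+-comm a j) (m≤o∸n⇒m+n≤o a j≤x a≤x∸j)))

  G-as-sum : ∀ c → G α β c ≡ ∑ (gAt (suc c)) ℓ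
  G-as-sum c = partial ℓ
    where
    partial : ∀ m → sumTo α β c m ≡ ∑ (gAt (suc c)) m
    partial zero    = refl
    partial (suc m) = cong (_+ gShift α β c (suc m)) (partial m)

  fuel-irrelevant : ∀ f f′ k → k ≤ f → k ≤ f′ → gAux α β f k ≡ gAux α β f′ k
  fuel-irrelevant f       f′       zero    _       _        = refl
  fuel-irrelevant (suc f) (suc f′) (suc k) (s≤s k≤f) (s≤s k≤f′) =
    cong₂ _+_ (term α 1≤α) (term β 1≤β)
    where
    term : ∀ a → 1 ≤ a → (if a ≤ᵇ suc k then gAux α β f (suc k ∸ a) else 0)
                       ≡ (if a ≤ᵇ suc k then gAux α β f′ (suc k ∸ a) else 0)
    term (suc a) _ = cong (λ v → if suc a ≤ᵇ suc k then v else 0)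
      (fuel-irrelevant f f′ (k ∸ a) (≤-trans (m∸n≤m k a) k≤f) (≤-trans (m∸n≤m k a) k≤f′))

  g-rec : ∀ k → g α β (suc k) ≡ gAt (suc k) α + gAt (suc k) β
  g-rec k = cong₂ _+_ (term α 1≤α) (term β 1≤β)
    where
    term : ∀ a → 1 ≤ a → (if a ≤ᵇ suc k then gAux α β k (suc k ∸ a) else 0) ≡ gAt (suc k) a
    term (suc a) _ = cong (λ v → if suc a ≤ᵇ suc k then v else 0)
      (fuel-irrelevant k (k ∸ a) (k ∸ a) (m∸n≤m k a) ≤-refl)

  gAt-rec : ∀ {x i} → i < x → gAt x i ≡ gAt x (α + i) + gAt x (β + i)
  gAt-rec {x} {i} i<x = begin
    gAt x i                               ≡⟨ gAt-above (<⇒≤ i<x) ⟩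
    g α β (x ∸ i)                         ≡⟨ cong (g α β) x∸i≡1+y ⟩
    g α β (suc (x ∸ suc i))               ≡⟨ g-rec (x ∸ suc i) ⟩
    gAt (suc (x ∸ suc i)) α + gAt (suc (x ∸ suc i)) β
                                          ≡⟨ cong (λ y → gAt y α + gAt y β) (sym x∸i≡1+y) ⟩
    gAt (x ∸ i) α + gAt (x ∸ i) β         ≡⟨ cong₂ _+_ (shifted α) (shifted β) ⟩
    gAt x (α + i) + gAt x (β + i)         ∎
    where
    open ≡-Reasoning
    x∸i≡1+y : x ∸ i ≡ suc (x ∸ suc i)
    x∸i≡1+y = +-∸-assoc 1 i<x
    shifted : ∀ a → gAt (x ∸ i) a ≡ gAt x (a + i)
    shifted a = trans (gAt-shift x i a (<⇒≤ i<x)) (cong (gAt x) (+-comm i a))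

  Gminus : ℕ → ℕ → ℕ
  Gminus c a = ∑ (λ i → gAt (suc c) (a + i)) ℓ

  Gminus-shift : ∀ {c a} → a ≤ c → Gminus c a ≡ G α β (c ∸ a)
  Gminus-shift {c} {a} a≤c = sym (trans (G-as-sum (c ∸ a)) (∑-cong ℓ term))
    where
    term : ∀ i → 1 ≤ i → i ≤ ℓ → gAt (suc (c ∸ a)) i ≡ gAt (suc c) (a + i)
    term i _ _ = trans (cong (λ y → gAt y i) (sym (+-∸-assoc 1 a≤c)))
                       (gAt-shift (suc c) a i (m≤n⇒m≤1+n a≤c))

  Gminus-vanish : ∀ {c a} → c < a → Gminus c a ≡ 0
  Gminus-vanish {c} {a} c<a = ∑-zero ℓ (λ i 1≤i _ → gAt-below (out-of-range i 1≤i))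
    where
    out-of-range : ∀ i → 1 ≤ i → suc c < a + i
    out-of-range i 1≤i = subst (_≤ a + i) (+-comm (suc c) 1) (+-mono-≤ c<a 1≤i)

  G-rec : ∀ {c} → ℓ ≤ c → G α β c ≡ Gminus c α + Gminus c β
  G-rec {c} ℓ≤c = begin
    G α β c                                               ≡⟨ G-as-sum c ⟩
    ∑ (gAt (suc c)) ℓ                                     ≡⟨ ∑-cong ℓ (λ i _ i≤ℓ → gAt-rec (s≤s (≤-trans i≤ℓ ℓ≤c))) ⟩
    ∑ (λ i → gAt (suc c) (α + i) + gAt (suc c) (β + i)) ℓ ≡⟨ ∑-+ _ _ ℓ ⟩
    Gminus c α + Gminus c β                               ∎
    where open ≡-Reasoning

  G-split : ∀ c → Gminus c α + Gminus c β ≤ G α β c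
  G-split c with ℓ ≤? c
  ... | yes ℓ≤c = ≤-reflexive (sym (G-rec ℓ≤c))
  ... | no ℓ≰c  = subst (_≤ G α β c) (sym both-vanish) z≤n
    where
    c<ℓ : c < ℓ
    c<ℓ = ≰⇒> ℓ≰c
    both-vanish : Gminus c α + Gminus c β ≡ 0
    both-vanish = cong₂ _+_ (Gminus-vanish (<-≤-trans c<ℓ (m⊓n≤m α β)))
                            (Gminus-vanish (<-≤-trans c<ℓ (m⊓n≤n α β)))

  -- G(c) ≥ 1, by strong induction: step down by α or β while possible;
  -- when c < ℓ, the term g(0) = 1 occurs in the sum.
  G-positive : ∀ c → 1 ≤ G α β c
  G-positive = <-rec (λ c → 1 ≤ G α β c) step
    where
    open ≤-Reasoning
    step : ∀ c → (∀ {y} → y < c → 1 ≤ G α β y) → 1 ≤ G α β c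
    step c ih with α ≤? c | β ≤? c
    ... | yes α≤c | _ = begin
      1                       ≤⟨ ih (∸-monoʳ-< 1≤α α≤c) ⟩
      G α β (c ∸ α)           ≡⟨ sym (Gminus-shift α≤c) ⟩
      Gminus c α              ≤⟨ m≤m+n _ _ ⟩
      Gminus c α + Gminus c β ≤⟨ G-split c ⟩
      G α β c                 ∎
    ... | no _ | yes β≤c = begin
      1                       ≤⟨ ih (∸-monoʳ-< 1≤β β≤c) ⟩
      G α β (c ∸ β)           ≡⟨ sym (Gminus-shift β≤c) ⟩
      Gminus c β              ≤⟨ m≤n+m _ _ ⟩
      Gminus c α + Gminus c β ≤⟨ G-split c ⟩
      G α β c                 ∎
    ... | no α≰c | no β≰c = begin
      1                       ≡⟨ sym (trans (gAt-above {suc c} ≤-refl) (cong (g α β) (n∸n≡0 (suc c)))) ⟩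
      gAt (suc c) (suc c)     ≤⟨ ∑-term _ ℓ (suc c) (s≤s z≤n) (⊓-glb (≰⇒> α≰c) (≰⇒> β≰c)) ⟩
      ∑ (gAt (suc c)) ℓ       ≡⟨ sym (G-as-sum c) ⟩
      G α β c                 ∎

module Trees (α β : ℕ) (1≤α : 1 ≤ α) (1≤β : 1 ≤ β) {n : ℕ} where
  open Recurrence α β 1≤α 1≤β

  record Solves (a : ℕ) (T : SearchTree n) (lo hi c : ℕ) : Set where
    constructor solving
    field
      at : ∀ (i : Fin n) → lo ≤ toℕ i → toℕ i < hi → result T i ≡ i × a + cost α β T i ≤ c

  first-index : ∀ {a T lo hi c} → Solves a T lo hi c → lo < hi → hi ≤ n →
    Σ (Fin n) λ i → toℕ i ≡ lo × result T i ≡ i × a + cost α β T i ≤ c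
  first-index {lo = lo} {hi} (solving ok) lo<hi hi≤n =
    i , i≡lo , ok i (≤-reflexive (sym i≡lo)) (subst (_< hi) (sym i≡lo) lo<hi)
    where
    lo<n : lo < n
    lo<n = <-≤-trans lo<hi hi≤n
    i : Fin n
    i = fromℕ< lo<n
    i≡lo : toℕ i ≡ lo
    i≡lo = toℕ-fromℕ< lo<n

  leaf-bound : ∀ {a r lo hi c} → Solves a (leaf r) lo hi c → hi ≤ n → hi ≤ suc lo
  leaf-bound {a} {r} {lo} {hi} solves@(solving ok) hi≤n with hi ≤? suc lo
  ... | yes hi≤1+lo = hi≤1+lo
  ... | no hi≰1+lo  = ⊥-elim (1+n≢n (sym lo≡1+lo))
    where
    1+lo<hi : suc lo < hi
    1+lo<hi = ≰⇒> hi≰1+lo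
    lo≡1+lo : lo ≡ suc lo
    lo≡1+lo with first-index solves (<⇒≤ 1+lo<hi) hi≤n
               | first-index {a} {leaf r} (solving λ i p q → ok i (≤-trans (n≤1+n lo) p) q) 1+lo<hi hi≤n
    ... | i₀ , i₀≡lo , r≡i₀ , _ | i₁ , i₁≡1+lo , r≡i₁ , _ =
      trans (sym i₀≡lo) (trans (cong toℕ (trans (sym r≡i₀) r≡i₁)) i₁≡1+lo)

  descend-true : ∀ {j t f} (i : Fin n) → toℕ i ≤ toℕ j →
    result (node j t f) i ≡ result t i × cost α β (node j t f) i ≡ α + cost α β t i
  descend-true {j} i i≤j rewrite ≤ᵇ-true i≤j = refl , refl

  descend-false : ∀ {j t f} (i : Fin n) → toℕ j < toℕ i →
    result (node j t f) i ≡ result f i × cost α β (node j t f) i ≡ β + cost α β f i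
  descend-false {j} i j<i rewrite ≤ᵇ-false j<i = refl , refl

  restrict : ∀ {a b T T′ lo hi lo′ hi′ c} → Solves a T lo hi c →
    (∀ i → lo′ ≤ toℕ i → toℕ i < hi′ →
       lo ≤ toℕ i × toℕ i < hi × result T i ≡ result T′ i × cost α β T i ≡ b + cost α β T′ i) →
    Solves b T′ lo′ hi′ (c ∸ a)
  restrict {a} {c = c} (solving ok) route = solving λ i lo′≤i i<hi′ →
    let (lo≤i , i<hi , result≡ , cost≡) = route i lo′≤i i<hi′
        (correct , within)              = ok i lo≤i i<hi
    in  trans (sym result≡) correct , spend a (subst (λ y → a + y ≤ c) cost≡ within)

  cut : ∀ {lo hi} → lo ≤ hi → ∀ s → Σ ℕ λ m → lo ≤ m × m ≤ hi ×
    (∀ i → lo ≤ i → i < m → i < s) × (∀ i → m ≤ i → i < hi → s ≤ i)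
  cut {lo} {hi} lo≤hi s with s ≤? lo
  ... | yes s≤lo = lo , ≤-refl , lo≤hi , (λ i lo≤i i<lo → ⊥-elim (<⇒≱ i<lo lo≤i)) , (λ i lo≤i _ → ≤-trans s≤lo lo≤i)
  ... | no s≰lo with hi ≤? s
  ...   | yes hi≤s = hi , lo≤hi , ≤-refl , (λ i _ i<hi → <-≤-trans i<hi hi≤s) , (λ i hi≤i i<hi → ⊥-elim (<⇒≱ i<hi hi≤i))
  ...   | no hi≰s  = s , <⇒≤ (≰⇒> s≰lo) , <⇒≤ (≰⇒> hi≰s) , (λ _ _ i<s → i<s) , (λ _ s≤i _ → s≤i)

  -- The main counting bound, by induction on the tree: solves-bound bounds
  -- a possibly empty interval; root-bound a nonempty one, where a ≤ c.
  mutual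
    solves-bound : ∀ {a} T {lo hi c} → Solves a T lo hi c → hi ≤ n → hi ≤ lo + Gminus c a
    solves-bound {a} T {lo} {hi} {c} solves hi≤n with hi ≤? lo
    ... | yes hi≤lo = ≤-trans hi≤lo (m≤m+n lo _)
    ... | no hi≰lo with first-index solves (≰⇒> hi≰lo) hi≤n
    ...   | _ , _ , _ , within =
      subst (λ x → hi ≤ lo + x) (sym (Gminus-shift (m+n≤o⇒m≤o a within)))
            (root-bound T solves (≰⇒> hi≰lo) hi≤n)

    root-bound : ∀ {a} T {lo hi c} → Solves a T lo hi c → lo < hi → hi ≤ n → hi ≤ lo + G α β (c ∸ a)
    root-bound {a} (leaf r) {lo} {hi} {c} solves _ hi≤n = begin
      hi                 ≤⟨ leaf-bound solves hi≤n ⟩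
      suc lo             ≡⟨ +-comm 1 lo ⟩
      lo + 1             ≤⟨ +-monoʳ-≤ lo (G-positive (c ∸ a)) ⟩
      lo + G α β (c ∸ a) ∎
      where open ≤-Reasoning
    root-bound {a} (node j t f) {lo} {hi} {c} solves lo<hi hi≤n with cut (<⇒≤ lo<hi) (suc (toℕ j))
    ... | m , lo≤m , m≤hi , below , above = begin
      hi                                           ≤⟨ solves-bound f false-part hi≤n ⟩
      m + Gminus c′ β                              ≤⟨ +-monoˡ-≤ _ (solves-bound t true-part (≤-trans m≤hi hi≤n)) ⟩
      lo + Gminus c′ α + Gminus c′ β               ≡⟨ +-assoc lo _ _ ⟩
      lo + (Gminus c′ α + Gminus c′ β)             ≤⟨ +-monoʳ-≤ lo (G-split c′) ⟩
      lo + G α β c′                                ∎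
      where
      open ≤-Reasoning
      c′ : ℕ
      c′ = c ∸ a
      true-part : Solves α t lo m c′
      true-part = restrict solves λ i lo≤i i<m →
        lo≤i , <-≤-trans i<m m≤hi , descend-true {j} {t} {f} i (s≤s⁻¹ (below (toℕ i) lo≤i i<m))
      false-part : Solves β f m hi c′
      false-part = restrict solves λ i m≤i i<hi →
        ≤-trans lo≤m m≤i , i<hi , descend-false {j} {t} {f} i (above (toℕ i) m≤i i<hi)

  tree-covers : ∀ {T c} → Solves 0 T 0 n c → n ≤ G α β c
  tree-covers {T} {c} solves = subst (n ≤_) (sym (G-as-sum c)) (solves-bound T solves ≤-refl)

proposition5 : (α β n : ℕ) → 1 ≤ α → 1 ≤ β → 1 ≤ n →
    (k : ℕ) → IsMinK α β n k →
    (T : SearchTree n) → Correct T → k ≤ worstCost α β T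
proposition5 α β n 1≤α 1≤β _ k (_ , minimal) T correct =
  minimal (worstCost α β T) (tree-covers solves-all)
  where
  open Trees α β 1≤α 1≤β
  solves-all : Solves 0 T 0 n (worstCost α β T)
  solves-all = solving λ i _ _ → correct i , ≤-foldr-⊔ (cost α β T) (∈-allFin i)
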